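{- Let $T$ be a complete tree with root $r$, and suppose $T$ is conflict-free $2$-edge-colorable. Let $T'=Sub_T(v)$ be a maximal full subtree of $T$. Then $2\le \ell(T')\le 5$, and for every conflict-free red/blue edge-coloring $C$ of $T$ in which red is a conflict-free color of every edge, the coloring pattern of $C$ on $T'$ belongs to $\{(B),(R),(B,D),(R,S),(R,S,S,D),(B,S,D)\}$.
   Context: A complete tree is a rooted tree whose root $r$ has degree $1$ and in which every non-root vertex with at least one son has at least two sons. Edges are oriented away from the root; $x^+$ denotes the father of a non-root vertex $x$. For a non-root vertex $v$, $Sub_T(v)$ is the subtree induced by $v^+$, $v$ and all descendants of $v$, rooted at $v^+$; the level of a vertex in it is its distance from $v^+$ and $L_i$ is the set of vertices at level $i$. $Sub_T(v)$ is a full tree if, for some $m\ge 1$, all vertices other than $v^+$ with no sons lie at level $m$ and every vertex at levels $1,\dots,m-1$ has at least two sons; its level is then $\ell(Sub_T(v))=m+1$. $Sub_T(v)$ is a maximal full subtree if $v^+\neq r$, $Sub_T(v)$ is a full tree and $Sub_T(v^+)$ is not a full tree. For an edge-coloring, a color is a conflict-free color of an edge $e=xy$ if it appears on exactly one edge of $E(x)\cup E(y)$ ($E(x)$ = edges incident with $x$); a coloring is conflict-free if every edge has a conflict-free color. For a red/blue coloring, a vertex with at least one son is an S-vertex if all edges to its sons are blue and a D-vertex if some edge to a son is red. For a full subtree $T'=Sub_T(v)$ with $\ell(T')=m+1$, in any such coloring $C$ (red being conflict-free for every edge) all vertices of $L_i(T')$, $1\le i\le m-1$, are of the same type $X_i\in\{S,D\}$;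 the coloring pattern of $C$ on $T'$ is $(c,X_1,\dots,X_{m-1})$ where $c=R$ if the edge $v^+v$ is red and $c=B$ if it is blue. -}

module Defs where

open import Data.Nat using (ℕ; zero; suc; _+_; _≤_; _<_; _∸_)
open import Data.Fin using (Fin; fromℕ<)
import Data.Fin as F
open import Data.List using (List; []; _∷_; length; lookup)
open import Data.List.Membership.Propositional using (_∈_)
open import Data.Product using (Σ; ∃; _×_; _,_)
open import Data.Empty using (⊥)
open import Data.Unit using (⊤)
open import Relation.Binary.PropositionalEquality using (_≡_; _≢_)
open import Relation.Nullary using (¬_)

data Tree : Set where
  node : List Tree → Tree

children : Tree → List Tree
children (node ts) = ts

deg : Tree → ℕ
deg t = length (children t)

-- Vertices of a tree, as paths from the root.
data Pos : Tree → Set where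
  here  : ∀ {t} → Pos t
  there : ∀ {ts} (i : Fin (length ts)) → Pos (lookup ts i) → Pos (node ts)

sub : (t : Tree) → Pos t → Tree
sub t here = t
sub (node ts) (there i p) = sub (lookup ts i) p

son : (t : Tree) (p : Pos t) → Fin (deg (sub t p)) → Pos t
son (node ts) here i = there i here
son (node ts) (there j p) i = there j (son (lookup ts j) p i)

depth : ∀ {t} → Pos t → ℕ
depth here = 0
depth (there i p) = suc (depth p)

NonRoot : ∀ {t} → Pos t → Set
NonRoot here = ⊥
NonRoot (there _ _) = ⊤

graft : ∀ {t} (p : Pos t) → Pos (sub t p) → Pos t
graft here q = q
graft {node ts} (there i p) q = there i (graft p q)

Complete : Tree → Set
Complete T = (deg T ≡ 1) × ((p : Pos T) → NonRoot p → deg (sub T p) ≢ 1)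

-- For a non-root vertex v of T, Sub_T(v) consists of v^+,
-- v and the descendants of v; it is determined by the tree s = sub T v
-- (rooted at v).  A vertex q of s lies at level (depth q + 1) of Sub_T(v).
-- Full m s : Sub_T(v) is a full tree with parameter m (level m+1):
-- all vertices other than v^+ with no sons lie at level m, and every
-- vertex at levels 1..m-1 has at least two sons.

Full : ℕ → Tree → Set
Full m s = (1 ≤ m) ×
  ((q : Pos s) →
     (deg (sub s q) ≡ 0 → suc (depth q) ≡ m) ×
     (suc (depth q) < m → 2 ≤ deg (sub s q)))

IsFull : Tree → Set
IsFull s = ∃ λ m → Full m s

-- Red/blue edge colorings. Each non-root vertex x carries the color of
-- the edge x^+ x. (The value at the root is irrelevant/unused.)

data Color : Set where
  red blue : Color

Coloring : Tree → Set
Coloring t = Pos t → Color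

_==_ : Color → Color → ℕ
red == red = 1
blue == blue = 1
red == blue = 0
blue == red = 0

sumFin : (n : ℕ) → (Fin n → ℕ) → ℕ
sumFin zero f = 0
sumFin (suc n) f = f F.zero + sumFin n (λ i → f (F.suc i))

upCount : ∀ {t} → Coloring t → Pos t → Color → ℕ
upCount C here c = 0
upCount C p@(there _ _) c = C p == c

downCount : ∀ {t} → Coloring t → Pos t → Color → ℕ
downCount {t} C p c = sumFin (deg (sub t p)) (λ i → C (son t p i) == c)

-- c is a conflict-free color of the edge xy, x = p, y = son t p i:
-- it appears exactly once on E(x) ∪ E(y)
-- (= up-edge of x, son-edges of x (including xy), son-edges of y).
CFColor : ∀ {t} → Coloring t → (p : Pos t) → Fin (deg (sub t p)) → Color → Set
CFColor {t} C p i c = upCount C p c + downCount C p c + downCount C (son t p i) c ≡ 1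

ConflictFree : ∀ {t} → Coloring t → Set
ConflictFree {t} C = (p : Pos t) (i : Fin (deg (sub t p))) → ∃ λ c → CFColor C p i c

CF2Colorable : Tree → Set
CF2Colorable t = ∃ λ (C : Coloring t) → ConflictFree C

RedCF : ∀ {t} → Coloring t → Set
RedCF {t} C = (p : Pos t) (i : Fin (deg (sub t p))) → CFColor C p i red

data VType : Set where
  S D : VType

HasType : ∀ {s} → Coloring s → Pos s → VType → Set
HasType {s} C q S = (1 ≤ deg (sub s q)) × ((j : Fin (deg (sub s q))) → C (son s q j) ≡ blue)
HasType {s} C q D = ∃ λ (j : Fin (deg (sub s q))) → C (son s q j) ≡ red

Pattern : Set
Pattern = Color × List VType

-- (c , X₁ ∷ … ∷ X_{m-1}) is the coloring pattern of C on Sub_T(v),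
-- v = son T u i, with ℓ(Sub_T(v)) = m + 1: the edge u v has color c,
-- and every vertex at level k (1 ≤ k ≤ m-1) of Sub_T(v) has type X_k.
PatternOf : (T : Tree) → Coloring T → (u : Pos T) → Fin (deg (sub T u)) → ℕ → Pattern → Set
PatternOf T C u i m (c , Xs) =
  (C (son T u i) ≡ c) × (length Xs ≡ m ∸ 1) ×
  ((q : Pos (sub T (son T u i))) (lt : depth q < length Xs) →
     HasType (λ x → C (graft (son T u i) x)) q (lookup Xs (fromℕ< lt)))

allowed : List Pattern
allowed = (blue , []) ∷ (red , []) ∷ (blue , D ∷ []) ∷ (red , S ∷ [])
        ∷ (red , S ∷ S ∷ D ∷ []) ∷ (blue , S ∷ D ∷ []) ∷ []

{-# OPTIONS --safe #-}
-- Let a color c be conflict-free on every edge of a full tree, and at each vertex q let up q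
-- count its c-colored father edge and down q its c-colored son edges. As every inner vertex
-- has at least two sons and all leaves lie on one level, these counts are forced by the height
-- h of q above the leaves. At h = 1 the edge to a leaf gives up + down = 1. At h = 2 the edge
-- to each son s′ gives up + down = up s′, while down ≥ up s₀ + up s₁; so up = down = 0. At
-- h = 3 the sons have up = 0, so down = 0 and up = 1. At h = 4 two sons with up = 1 would give
-- down ≥ 2. Hence ℓ ≤ 5, and with c = red the counts level by level give the pattern.
-- A conflict-free 2-coloring yields such a c: a vertex with two sons lies on three edges, so
-- it cannot meet both colors at most once, and therefore the conflict-free color of one edge
-- at the root is conflict-free on every edge below it.

module Submission where

open import Defs
open import Data.Nat using (ℕ; zero; suc; _+_; _≤_; _<_; _∸_; z≤n; s≤s)
open import Data.Nat.Properties
open import Data.Fin using (Fin; fromℕ<) renaming (zero to fzero; suc to fsuc)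
open import Data.List using (List; []; _∷_; length; lookup)
open import Data.List.Membership.Propositional using (_∈_)
import Data.List.Relation.Unary.Any as Any
open import Data.Product using (∃; ∃₂; _×_; _,_; proj₁; proj₂)
open import Data.Sum using (_⊎_; inj₁; inj₂)
open import Data.Empty using (⊥; ⊥-elim)
open import Data.Unit using (⊤; tt)
open import Function using (_∘_)
open import Relation.Nullary using (¬_)
open import Relation.Binary.PropositionalEquality

term≤sumFin : ∀ k (f : Fin k → ℕ) j → f j ≤ sumFin k f
term≤sumFin (suc k) f fzero    = m≤m+n (f fzero) _
term≤sumFin (suc k) f (fsuc j) = ≤-trans (term≤sumFin k (f ∘ fsuc) j) (m≤n+m _ (f fzero))

two-terms≤sumFin : ∀ k → 2 ≤ k → ∃₂ λ (j₀ j₁ : Fin k) → ∀ f → f j₀ + f j₁ ≤ sumFin k f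
two-terms≤sumFin (suc (suc k)) (s≤s (s≤s _)) =
  fzero , fsuc fzero , λ f → +-monoʳ-≤ (f fzero) (m≤m+n (f (fsuc fzero)) _)

sumFin≡0 : ∀ k (f : Fin k → ℕ) → (∀ j → f j ≡ 0) → sumFin k f ≡ 0
sumFin≡0 zero    f _   = refl
sumFin≡0 (suc k) f f≡0 = cong₂ _+_ (f≡0 fzero) (sumFin≡0 k (f ∘ fsuc) (f≡0 ∘ fsuc))

sumFin>0⇒term>0 : ∀ k (f : Fin k → ℕ) → 0 < sumFin k f → ∃ λ j → 0 < f j
sumFin>0⇒term>0 (suc k) f pos with f fzero in eq
... | suc _ = fzero , subst (0 <_) (sym eq) (s≤s z≤n)
... | zero with sumFin>0⇒term>0 k (f ∘ fsuc) pos
...   | j , f[j]>0 = fsuc j , f[j]>0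

==≡1⇒≡ : ∀ x c → (x == c) ≡ 1 → x ≡ c
==≡1⇒≡ red  red  _ = refl
==≡1⇒≡ blue blue _ = refl

==red≡0⇒≡blue : ∀ x → (x == red) ≡ 0 → x ≡ blue
==red≡0⇒≡blue blue _ = refl

==red>0⇒≡red : ∀ x → 0 < (x == red) → x ≡ red
==red>0⇒≡red red _ = refl

==red+n≡1 : ∀ x n → (x == red) + n ≡ 1 → (x ≡ red × n ≡ 0) ⊎ (x ≡ blue × n ≡ 1)
==red+n≡1 red  _ refl = inj₁ (refl , refl)
==red+n≡1 blue _ n≡1  = inj₂ (refl , n≡1)

three-edges-repeat-a-color : ∀ x y z →
  (x == red) + ((y == red) + (z == red)) ≤ 1 →
  (x == blue) + ((y == blue) + (z == blue)) ≤ 1 → ⊥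
three-edges-repeat-a-color red  red  _    (s≤s ()) _
three-edges-repeat-a-color red  blue red  (s≤s ()) _
three-edges-repeat-a-color red  blue blue _        (s≤s ())
three-edges-repeat-a-color blue red  red  (s≤s ()) _
three-edges-repeat-a-color blue red  blue _        (s≤s ())
three-edges-repeat-a-color blue blue _    _        (s≤s ())

data SnocView {t : Tree} : Pos t → Set where
  root : SnocView here
  _▷_  : ∀ {p} → SnocView p → (k : Fin (deg (sub t p))) → SnocView (son t p k)

there-view : ∀ {ts} (i : Fin (length ts)) {q} →
  SnocView {lookup ts i} q → SnocView {node ts} (there i q)
there-view i root    = root ▷ i
there-view i (v ▷ k) = there-view i v ▷ k

snocView : ∀ {t} (q : Pos t) → SnocView q
snocView here        = root
snocView (there i q) = there-view i (snocView q)

depth-son : ∀ t (p : Pos t) (k : Fin (deg (sub t p))) → depth (son t p k) ≡ suc (depth p)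
depth-son (node ts) here        k = refl
depth-son (node ts) (there i p) k = cong suc (depth-son (lookup ts i) p k)

son-nonRoot : ∀ t (p : Pos t) (k : Fin (deg (sub t p))) → NonRoot (son t p k)
son-nonRoot (node ts) here        k = tt
son-nonRoot (node ts) (there i p) k = tt

leaf-below : ∀ {t} (p : Pos t) → ∃ λ q → deg (sub t q) ≡ 0 × depth p ≤ depth q
leaf-below {node []}      here        = here , refl , z≤n
leaf-below {node (t ∷ _)} here        with leaf-below {t} here
... | q , leaf , _ = there fzero q , leaf , z≤n
leaf-below {node ts}      (there i p) with leaf-below p
... | q , leaf , p≤q = there i q , leaf , s≤s p≤q

graft-here : ∀ {t} (p : Pos t) → graft p here ≡ p
graft-here           here        = refl
graft-here {node ts} (there i p) = cong (there i) (graft-here p)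

son-graft : ∀ {t} (p : Pos t) (q : Pos (sub t p)) (k : Fin (deg (sub (sub t p) q))) →
  ∃ λ (k′ : Fin (deg (sub t (graft p q)))) →
    son t (graft p q) k′ ≡ graft p (son (sub t p) q k)
son-graft           here        q k = k , refl
son-graft {node ts} (there i p) q k with son-graft p q k
... | k′ , eq = k′ , cong (there i) eq

Branching : Tree → Set
Branching s = ∀ q → Fin (deg (sub s q)) → 2 ≤ deg (sub s q)

full⇒inner-level<m : ∀ {m s} → Full m s → ∀ q → Fin (deg (sub s q)) → suc (depth q) < m
full⇒inner-level<m {s = s} (_ , levels) q k with leaf-below (son s q k)
... | leaf , no-sons , son≤leaf = begin-strict
  suc (depth q)           <⟨ s≤s (≤-reflexive (sym (depth-son s q k))) ⟩
  suc (depth (son s q k)) ≤⟨ s≤s son≤leaf ⟩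
  suc (depth leaf)        ≡⟨ proj₁ (levels leaf) no-sons ⟩
  _                       ∎
  where open ≤-Reasoning

full⇒branching : ∀ {m s} → Full m s → Branching s
full⇒branching full@(_ , levels) q k = proj₂ (levels q) (full⇒inner-level<m full q k)

restrict : ∀ {t} → Coloring t → (p : Pos t) → Coloring (sub t p)
restrict C p = C ∘ graft p

count : ∀ {s} → Coloring s → Color → Pos s → ℕ
count K c q = (K q == c) + downCount K q c

-- The root of Sub_T(v) keeps its father edge, whose color K stores at the root.
LocalCF : ∀ {s} → Coloring s → Color → (q : Pos s) → Fin (deg (sub s q)) → Set
LocalCF {s} K c q k = count K c q + downCount K (son s q k) c ≡ 1

downCount-graft : ∀ {t} (C : Coloring t) (p : Pos t) (q : Pos (sub t p)) c →
  downCount C (graft p q) c ≡ downCount (restrict C p) q c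
downCount-graft           C here        q c = refl
downCount-graft {node ts} C (there i p) q c = downCount-graft (C ∘ there i) p q c

cfColor⇒localCF : ∀ {t} (C : Coloring t) (p : Pos t) → NonRoot p → ∀ q k →
  ∃ λ k′ → ∀ c → CFColor C (graft p q) k′ c → LocalCF (restrict C p) c q k
cfColor⇒localCF {t} C p@(there _ _) _ q k with son-graft p q k
... | k′ , son≡ = k′ , λ c → trans (counts≡ c)
  where
  counts≡ : ∀ c →
    count (restrict C p) c q + downCount (restrict C p) (son (sub t p) q k) c ≡
    upCount C (graft p q) c + downCount C (graft p q) c + downCount C (son t (graft p q) k′) c
  counts≡ c = cong₂ _+_
    (cong ((C (graft p q) == c) +_) (sym (downCount-graft C p q c)))
    (sym (trans (cong (λ x → downCount C x c) son≡) (downCount-graft C p _ c)))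

restrict-conflictFree : ∀ {t} {C : Coloring t} → ConflictFree C → (p : Pos t) → NonRoot p →
  ∀ q k → ∃ λ c → LocalCF (restrict C p) c q k
restrict-conflictFree {C = C} cf p p≢root q k with cfColor⇒localCF C p p≢root q k
... | k′ , local with cf (graft p q) k′
...   | c , c-cf = c , local c c-cf

restrict-redCF : ∀ {t} {C : Coloring t} → RedCF C → (p : Pos t) → NonRoot p →
  ∀ q k → LocalCF (restrict C p) red q k
restrict-redCF {C = C} red-cf p p≢root q k with cfColor⇒localCF C p p≢root q k
... | k′ , local = local red (red-cf (graft p q) k′)

AtMostOnce : ∀ {s} → Coloring s → Color → Pos s → Set
AtMostOnce K c q = count K c q ≤ 1

module _ {s : Tree} (K : Coloring s) where

  localCF⇒atMostOnce-father : ∀ {c q k} → LocalCF K c q k → AtMostOnce K c q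
  localCF⇒atMostOnce-father cf = ≤-trans (m≤m+n _ _) (≤-reflexive cf)

  localCF⇒atMostOnce-son : ∀ {c q k} → LocalCF K c q k → AtMostOnce K c (son s q k)
  localCF⇒atMostOnce-son {c} {q} {k} cf = begin
    (K (son s q k) == c) + downCount K (son s q k) c
      ≤⟨ +-monoˡ-≤ _ (term≤sumFin _ (λ j → K (son s q j) == c) k) ⟩
    downCount K q c + downCount K (son s q k) c
      ≤⟨ +-monoˡ-≤ _ (m≤n+m _ (K q == c)) ⟩
    count K c q + downCount K (son s q k) c
      ≡⟨ cf ⟩
    1 ∎
    where open ≤-Reasoning

  ¬atMostOnce-both : ∀ {q} → 2 ≤ deg (sub s q) → AtMostOnce K red q → AtMostOnce K blue q → ⊥
  ¬atMostOnce-both {q} two-sons red≤1 blue≤1 with two-terms≤sumFin _ two-sons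
  ... | k₀ , k₁ , two-terms = three-edges-repeat-a-color (K q) (K (son s q k₀)) (K (son s q k₁))
    (≤-trans (+-monoʳ-≤ (K q == red) (two-terms (λ k → K (son s q k) == red))) red≤1)
    (≤-trans (+-monoʳ-≤ (K q == blue) (two-terms (λ k → K (son s q k) == blue))) blue≤1)

  atMostOnce⇒localCF : ∀ {c c′ q k} → 2 ≤ deg (sub s q) →
    AtMostOnce K c q → LocalCF K c′ q k → LocalCF K c q k
  atMostOnce⇒localCF {red}  {red}  _        _     cf = cf
  atMostOnce⇒localCF {blue} {blue} _        _     cf = cf
  atMostOnce⇒localCF {red}  {blue} two-sons red≤1 cf =
    ⊥-elim (¬atMostOnce-both two-sons red≤1 (localCF⇒atMostOnce-father cf))
  atMostOnce⇒localCF {blue} {red}  two-sons blue≤1 cf =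
    ⊥-elim (¬atMostOnce-both two-sons (localCF⇒atMostOnce-father cf) blue≤1)

  localCF-everywhere : Branching s → (∀ q k → ∃ λ c → LocalCF K c q k) →
    ∀ {c k₀} → LocalCF K c here k₀ → ∀ q k → LocalCF K c q k
  localCF-everywhere branching cf {c} c-cf₀ q k =
    atMostOnce⇒localCF (branching q k) (atMostOnce (snocView q)) (proj₂ (cf q k))
    where
    atMostOnce : ∀ {q} → SnocView q → AtMostOnce K c q
    atMostOnce root    = localCF⇒atMostOnce-father c-cf₀
    atMostOnce (_▷_ {p} view k) = localCF⇒atMostOnce-son
      (atMostOnce⇒localCF (branching p k) (atMostOnce view) (proj₂ (cf p k)))

m+m≤m⇒m≡0 : ∀ m → m + m ≤ m → m ≡ 0
m+m≤m⇒m≡0 m m+m≤m =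
  n≤0⇒n≡0 (+-cancelˡ-≤ m m 0 (≤-trans m+m≤m (≤-reflexive (sym (+-identityʳ m)))))

module Profiles {s : Tree} (K : Coloring s) (c : Color) where

  up down : Pos s → ℕ
  up q   = K q == c
  down q = downCount K q c

  Profile : ℕ → Pos s → Set
  Profile 0 q = down q ≡ 0
  Profile 1 q = up q + down q ≡ 1
  Profile 2 q = up q ≡ 0 × down q ≡ 0
  Profile 3 q = up q ≡ 1 × down q ≡ 0
  Profile (suc (suc (suc (suc _)))) q = ⊥

  up-son≤down : ∀ q k → up (son s q k) ≤ down q
  up-son≤down q = term≤sumFin _ (up ∘ son s q)

  down≡0⇒up-son≡0 : ∀ q k → down q ≡ 0 → up (son s q k) ≡ 0
  down≡0⇒up-son≡0 q k down≡0 = n≤0⇒n≡0 (≤-trans (up-son≤down q k) (≤-reflexive down≡0))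

  profile⇒height≤3 : ∀ h {q} → Profile h q → h ≤ 3
  profile⇒height≤3 0 _ = z≤n
  profile⇒height≤3 1 _ = s≤s z≤n
  profile⇒height≤3 2 _ = s≤s (s≤s z≤n)
  profile⇒height≤3 3 _ = s≤s (s≤s (s≤s z≤n))

  profile⇒down≡0 : ∀ h {q} → Profile (2 + h) q → down q ≡ 0
  profile⇒down≡0 0 = proj₂
  profile⇒down≡0 1 = proj₂

  module _ {q : Pos s} (cf : ∀ k → LocalCF K c q k) where

    count≤1 : ∀ k → up q + down q ≤ 1
    count≤1 k = ≤-trans (m≤m+n _ _) (≤-reflexive (cf k))

    count≡1 : ∀ k → down (son s q k) ≡ 0 → up q + down q ≡ 1
    count≡1 k down≡0 = begin
      up q + down q                      ≡⟨ +-identityʳ _ ⟨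
      up q + down q + 0                  ≡⟨ cong (up q + down q +_) down≡0 ⟨
      up q + down q + down (son s q k)   ≡⟨ cf k ⟩
      1                                  ∎
      where open ≡-Reasoning

    count≡up-son : ∀ k → Profile 1 (son s q k) → up q + down q ≡ up (son s q k)
    count≡up-son k son-cf = +-cancelʳ-≡ (down (son s q k)) _ _ (trans (cf k) (sym son-cf))

    profile-step : ∀ h → 2 ≤ deg (sub s q) → (∀ k → Profile h (son s q k)) → Profile (suc h) q
    profile-step h two-sons sons with two-terms≤sumFin _ two-sons
    ... | k₀ , k₁ , two-terms = step h sons
      where
      ups≤count : up (son s q k₀) + up (son s q k₁) ≤ up q + down q
      ups≤count = ≤-trans (two-terms (up ∘ son s q)) (m≤n+m _ (up q))

      step : ∀ h → (∀ k → Profile h (son s q k)) → Profile (suc h) q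
      step 0 sons = count≡1 k₀ (sons k₀)
      step 1 sons = m+n≡0⇒m≡0 (up q) count≡0 , m+n≡0⇒n≡0 (up q) count≡0
        where
        count≡0 : up q + down q ≡ 0
        count≡0 = m+m≤m⇒m≡0 _ (subst₂ (λ a b → a + b ≤ up q + down q)
          (sym (count≡up-son k₀ (sons k₀))) (sym (count≡up-son k₁ (sons k₁))) ups≤count)
      step 2 sons = up≡1 , down≡0
        where
        down≡0 : down q ≡ 0
        down≡0 = sumFin≡0 _ (up ∘ son s q) (proj₁ ∘ sons)
        up≡1 : up q ≡ 1
        up≡1 = begin
          up q          ≡⟨ +-identityʳ (up q) ⟨
          up q + 0      ≡⟨ cong (up q +_) down≡0 ⟨
          up q + down q ≡⟨ count≡1 k₀ (proj₂ (sons k₀)) ⟩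
          1             ∎
          where open ≡-Reasoning
      step 3 sons = ⊥-elim (<-irrefl refl (begin-strict
        1                                    <⟨ s≤s (s≤s z≤n) ⟩
        2                                    ≡⟨ cong₂ _+_ (proj₁ (sons k₀)) (proj₁ (sons k₁)) ⟨
        up (son s q k₀) + up (son s q k₁)    ≤⟨ ups≤count ⟩
        up q + down q                        ≤⟨ count≤1 k₀ ⟩
        1                                    ∎))
        where open ≤-Reasoning
      step (suc (suc (suc (suc _)))) sons = sons k₀

  module _ {m} (full : Full m s) (cf : ∀ q k → LocalCF K c q k) where

    profile : ∀ h q → suc (depth q) + h ≡ m → Profile h q
    profile 0 q leaf-level = sumFin≡0 _ _ λ k →
      ⊥-elim (<-irrefl (trans (sym (+-identityʳ _)) leaf-level) (full⇒inner-level<m full q k))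
    profile (suc h) q level =
      profile-step (cf q) h two-sons λ k → profile h (son s q k) (son-level k)
      where
      two-sons : 2 ≤ deg (sub s q)
      two-sons = proj₂ (proj₂ full q) (≤-trans (m<m+n _ (s≤s z≤n)) (≤-reflexive level))
      son-level : ∀ k → suc (depth (son s q k)) + h ≡ m
      son-level k = begin
        suc (depth (son s q k)) + h ≡⟨ cong (λ d → suc d + h) (depth-son s q k) ⟩
        suc (suc (depth q)) + h     ≡⟨ +-suc (suc (depth q)) h ⟨
        suc (depth q) + suc h       ≡⟨ level ⟩
        m                           ∎
        where open ≡-Reasoning

ByLevel : ∀ {s} → Coloring s → ℕ → List VType → Set
ByLevel K d []       = ⊤
ByLevel K d (X ∷ Xs) = (∀ q → depth q ≡ d → HasType K q X) × ByLevel K (suc d) Xs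

byLevel-lookup : ∀ {s} {K : Coloring s} Xs {d} → ByLevel K d Xs →
  ∀ q e → depth q ≡ d + e → (e<len : e < length Xs) → HasType K q (lookup Xs (fromℕ< e<len))
byLevel-lookup (X ∷ Xs) (types , _) q zero    depth≡ _ = types q (trans depth≡ (+-identityʳ _))
byLevel-lookup (X ∷ Xs) (_ , types) q (suc e) depth≡ (s≤s e<len) =
  byLevel-lookup Xs types q e (trans depth≡ (+-suc _ e)) e<len

PatternAt : ∀ {s} → Coloring s → ℕ → Pattern → Set
PatternAt K m (c , Xs) = (K here ≡ c) × (length Xs ≡ m ∸ 1) × ByLevel K 0 Xs

patternAt⇒patternOf : ∀ T (C : Coloring T) u i m pat →
  PatternAt (restrict C (son T u i)) m pat → PatternOf T C u i m pat
patternAt⇒patternOf T C u i m (c , Xs) (root-color , length≡ , types) =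
  trans (cong C (sym (graft-here (son T u i)))) root-color , length≡ ,
  λ q e<len → byLevel-lookup Xs types q (depth q) refl e<len

lone-edge∈allowed : ∀ c → (c , []) ∈ allowed
lone-edge∈allowed blue = Any.here refl
lone-edge∈allowed red  = Any.there (Any.here refl)

module RedPatterns {s : Tree} (K : Coloring s) (red-cf : ∀ q k → LocalCF K red q k) where
  open Profiles K red

  at-root : ∀ {X} → HasType K here X → ∀ q → depth q ≡ 0 → HasType K q X
  at-root type here _ = type

  S-type : ∀ {m} → Full m s → ∀ q → suc (depth q) < m → down q ≡ 0 → HasType K q S
  S-type (_ , full) q internal down≡0 =
    ≤-trans (s≤s z≤n) (proj₂ (full q) internal) ,
    λ k → ==red≡0⇒≡blue _ (down≡0⇒up-son≡0 q k down≡0)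

  D-type : ∀ q → down q ≡ 1 → HasType K q D
  D-type q down≡1 with sumFin>0⇒term>0 _ (up ∘ son s q) (≤-reflexive (sym down≡1))
  ... | k , red-son = k , ==red>0⇒≡red _ red-son

  S-type-above-height-1 : ∀ {m} → Full m s → ∀ q {d} h →
    depth q ≡ d → suc d + (2 + h) ≡ m → HasType K q S
  S-type-above-height-1 full q h refl level =
    S-type full q (≤-trans (m<m+n _ (s≤s z≤n)) (≤-reflexive level))
      (profile⇒down≡0 h (profile full red-cf (2 + h) q level))

  D-type-at-height-1 : ∀ {m} → Full m s → ∀ q {d} →
    depth q ≡ suc d → suc (suc d) + 1 ≡ m → HasType K q D
  D-type-at-height-1 full q dq level with snocView q
  D-type-at-height-1 full .here () level | root
  D-type-at-height-1 full .(son s p k) {d} dq level | _▷_ {p} _ k =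
    D-type (son s p k) (subst (λ x → x + down (son s p k) ≡ 1) up≡0
      (profile full red-cf 1 (son s p k) (trans (cong (λ x → suc x + 1) dq) level)))
    where
    depth-p : depth p ≡ d
    depth-p = suc-injective (trans (sym (depth-son s p k)) dq)
    up≡0 : up (son s p k) ≡ 0
    up≡0 = down≡0⇒up-son≡0 p k (profile⇒down≡0 0 (profile full red-cf 2 p
      (trans (cong (λ x → suc x + 2) depth-p) (trans (+-suc (suc d) 1) level))))

  red-pattern : ∀ m → Full m s → ∃ λ pat → pat ∈ allowed × PatternAt K m pat
  red-pattern 0 (() , _)
  red-pattern 1 _ = (K here , []) , lone-edge∈allowed (K here) , refl , refl , tt
  red-pattern 2 full with ==red+n≡1 (K here) _ (profile full red-cf 1 here refl)
  ... | inj₁ (red-root , down≡0) =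
    (red , S ∷ []) , Any.there (Any.there (Any.there (Any.here refl))) , red-root , refl ,
    at-root {X = S} (S-type full here (s≤s (s≤s z≤n)) down≡0) , tt
  ... | inj₂ (blue-root , down≡1) =
    (blue , D ∷ []) , Any.there (Any.there (Any.here refl)) , blue-root , refl ,
    at-root {X = D} (D-type here down≡1) , tt
  red-pattern 3 full =
    (blue , S ∷ D ∷ []) ,
    Any.there (Any.there (Any.there (Any.there (Any.there (Any.here refl))))) ,
    ==red≡0⇒≡blue _ (proj₁ (profile full red-cf 2 here refl)) , refl ,
    (λ q dq → S-type-above-height-1 full q 0 dq refl) ,
    (λ q dq → D-type-at-height-1 full q dq refl) , tt
  red-pattern 4 full =
    (red , S ∷ S ∷ D ∷ []) , Any.there (Any.there (Any.there (Any.there (Any.here refl)))) ,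
    ==≡1⇒≡ _ red (proj₁ (profile full red-cf 3 here refl)) , refl ,
    (λ q dq → S-type-above-height-1 full q 1 dq refl) ,
    (λ q dq → S-type-above-height-1 full q 0 dq refl) ,
    (λ q dq → D-type-at-height-1 full q dq refl) , tt
  red-pattern (suc (suc (suc (suc (suc h))))) full =
    ⊥-elim (profile full red-cf (4 + h) here refl)

level-bounds : ∀ {m s} → Full m s → (K : Coloring s) → (∀ q k → ∃ λ c → LocalCF K c q k) →
  2 ≤ suc m × suc m ≤ 5
level-bounds {zero}        (() , _) _ _
level-bounds {suc zero}    _        _ _  = s≤s (s≤s z≤n) , s≤s (s≤s z≤n)
level-bounds {suc (suc h)} {s} full K cf =
  s≤s (s≤s z≤n) ,
  s≤s (s≤s (profile⇒height≤3 (suc h) (profile full c-everywhere (suc h) here refl)))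
  where
  k₀ : Fin (deg s)
  k₀ = fromℕ< (proj₂ (proj₂ full here) (s≤s (s≤s z≤n)))
  c : Color
  c = proj₁ (cf here k₀)
  c-everywhere : ∀ q k → LocalCF K c q k
  c-everywhere = localCF-everywhere K (full⇒branching full) cf (proj₂ (cf here k₀))
  open Profiles K c

lemma3 : (T : Tree) → Complete T → CF2Colorable T →
         (u : Pos T) → NonRoot u → (i : Fin (deg (sub T u))) →
         (m : ℕ) → Full m (sub T (son T u i)) → ¬ IsFull (sub T u) →
         (2 ≤ suc m × suc m ≤ 5) ×
         ((C : Coloring T) → ConflictFree C → RedCF C →
            ∃ λ pat → pat ∈ allowed × PatternOf T C u i m pat)
lemma3 T _ (C₀ , C₀-cf) u _ i m full _ =
  level-bounds full (restrict C₀ v) (restrict-conflictFree C₀-cf v v-nonRoot) , allowed-pattern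
  where
  v : Pos T
  v = son T u i
  v-nonRoot : NonRoot v
  v-nonRoot = son-nonRoot T u i
  allowed-pattern : (C : Coloring T) → ConflictFree C → RedCF C →
    ∃ λ pat → pat ∈ allowed × PatternOf T C u i m pat
  allowed-pattern C _ red-cf
    with RedPatterns.red-pattern (restrict C v) (restrict-redCF red-cf v v-nonRoot) m full
  ... | pat , pat∈allowed , pattern-at =
    pat , pat∈allowed , patternAt⇒patternOf T C u i m pat pattern-at
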